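{- For all integers $a, n \geq 1$ and every prime number $p$ not dividing $a$, we have $\mathcal{D}_{ap}(n) = \mathcal{D}_a(pn) \setminus \mathcal{D}_a(n)$.
   Context: For integers $a, n \geq 1$, $\mathcal{D}_a(n) := \{d \in \mathbb{N} : d \mid an,\ \gcd(an/d, a) = 1\}$. -}

module Defs where

open import Data.Nat using (ℕ; _*_)
open import Data.Nat.Divisibility using (_∣_; quotient)
open import Data.Nat.Coprimality using (Coprime)
open import Data.Product using (Σ)

-- d ∈ 𝒟_a(n)  :⇔  d ∣ a n  and  gcd(a n / d, a) = 1,
-- where a n / d is the quotient carried by the divisibility proof
-- (unique since a n ≥ 1 in the statement).
InD : ℕ → ℕ → ℕ → Set
InD a n d = Σ (d ∣ a * n) λ h → Coprime (quotient h) a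

-- Write q for the cofactor of d in m p.  If d ∣ m, cancelling d shows that q is p times the
-- cofactor of d in m; conversely p ∣ q gives d ∣ m with cofactor q / p ∣ q.  Hence, once q is
-- coprime to k, the divisor d has a cofactor in m coprime to k exactly when p ∣ q.  Since
-- q is coprime to k p iff it is coprime to k and not divisible by p, this splits the divisors
-- of m p with cofactor coprime to k p off from those with cofactor coprime to k.  With k = a
-- and m = a n this is the theorem.
module Submission where

open import Defs
open import Data.Nat using (ℕ; zero; suc; _*_; _≥_; NonZero; >-nonZero; ≢-nonZero⁻¹)
open import Data.Nat.Properties using (*-assoc; *-comm; *-cancelʳ-≡; m*n≢0)
open import Data.Nat.Divisibility
  using (_∣_; divides; quotient; ∣-trans; ∣-refl; m∣m*n; n∣m*n; 0∣⇒≡0)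
open import Data.Nat.Primality using (Prime; prime⇒irreducible; prime⇒nonZero)
open import Data.Nat.Coprimality using (Coprime; coprime-divisor)
import Data.Nat.Coprimality as Coprimality
open import Data.Product using (Σ; _×_; _,_)
open import Data.Sum using (inj₁; inj₂)
open import Relation.Nullary using (¬_; contradiction)
open import Relation.Binary.PropositionalEquality
  using (_≡_; refl; sym; trans; cong; subst₂; module ≡-Reasoning)
open import Function.Base using (_∘_)
open import Function.Bundles using (_⇔_; mk⇔; module Equivalence)

variable
  d k m n o p r : ℕ

divisor-nonZero : .{{NonZero n}} → m ∣ n → NonZero m
divisor-nonZero {n} {zero}  0∣n = contradiction (0∣⇒≡0 0∣n) (≢-nonZero⁻¹ n)
divisor-nonZero {m = suc _} _   = _

prime≢1 : Prime p → ¬ p ≡ 1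
prime≢1 pp refl with pp
... | ()

coprime-∣ˡ : m ∣ n → Coprime n o → Coprime m o
coprime-∣ˡ m∣n c (k∣m , k∣o) = c (∣-trans k∣m m∣n , k∣o)

coprime-∣ʳ : m ∣ n → Coprime o n → Coprime o m
coprime-∣ʳ m∣n c = Coprimality.sym (coprime-∣ˡ m∣n (Coprimality.sym c))

coprime-*ʳ : Coprime m n → Coprime m o → Coprime m (n * o)
coprime-*ʳ c₁ c₂ (k∣m , k∣no) =
  c₂ (k∣m , coprime-divisor (coprime-∣ˡ k∣m c₁) k∣no)

coprime-prime⇔∤ : Prime p → Coprime m p ⇔ (¬ p ∣ m)
coprime-prime⇔∤ {p} {m} pp = mk⇔ coprime⇒∤ ∤⇒coprime
  where
  coprime⇒∤ : Coprime m p → ¬ p ∣ m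
  coprime⇒∤ c p∣m = prime≢1 pp (c (p∣m , ∣-refl))
  ∤⇒coprime : ¬ p ∣ m → Coprime m p
  ∤⇒coprime p∤m {k} (k∣m , k∣p) with prime⇒irreducible pp k∣p
  ... | inj₁ k≡1  = k≡1
  ... | inj₂ refl = contradiction k∣m p∤m

coprime-*-prime⇔ : Prime p → Coprime m (n * p) ⇔ (Coprime m n × ¬ p ∣ m)
coprime-*-prime⇔ {p} {m} {n} pp = mk⇔ split join
  where
  open Equivalence (coprime-prime⇔∤ {m = m} pp)
  split : Coprime m (n * p) → Coprime m n × ¬ p ∣ m
  split c = coprime-∣ʳ (m∣m*n p) c , to (coprime-∣ʳ (n∣m*n n) c)
  join : Coprime m n × ¬ p ∣ m → Coprime m (n * p)
  join (c , p∤m) = coprime-*ʳ c (from p∤m)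

quotient-*ʳ : .{{NonZero d}} → (h : d ∣ m) (h′ : d ∣ m * p) → quotient h′ ≡ quotient h * p
quotient-*ʳ {d} {m} {p} (divides r m≡rd) (divides q mp≡qd) = *-cancelʳ-≡ q (r * p) d (begin
  q * d       ≡⟨ sym mp≡qd ⟩
  m * p       ≡⟨ cong (_* p) m≡rd ⟩
  r * d * p   ≡⟨ *-assoc r d p ⟩
  r * (d * p) ≡⟨ cong (r *_) (*-comm d p) ⟩
  r * (p * d) ≡⟨ *-assoc r p d ⟨
  r * p * d   ∎)
  where open ≡-Reasoning

quotient≡*ʳ⇒∣ : .{{NonZero p}} → (h′ : d ∣ m * p) → quotient h′ ≡ r * p → m ≡ r * d
quotient≡*ʳ⇒∣ {p} {d} {m} {r} (divides q mp≡qd) q≡rp = *-cancelʳ-≡ m (r * d) p (begin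
  m * p       ≡⟨ mp≡qd ⟩
  q * d       ≡⟨ cong (_* d) q≡rp ⟩
  r * p * d   ≡⟨ *-assoc r p d ⟩
  r * (p * d) ≡⟨ cong (r *_) (*-comm p d) ⟩
  r * (d * p) ≡⟨ *-assoc r d p ⟨
  r * d * p   ∎)
  where open ≡-Reasoning

CoprimeCofactor : ℕ → ℕ → ℕ → Set
CoprimeCofactor k d m = Σ (d ∣ m) λ h → Coprime (quotient h) k

coprimeCofactor⇔∣quotient : .{{NonZero d}} → .{{NonZero p}} → (h : d ∣ m * p) →
  Coprime (quotient h) k → CoprimeCofactor k d m ⇔ p ∣ quotient h
coprimeCofactor⇔∣quotient {p = p} h c = mk⇔
  (λ (h₀ , _) → divides (quotient h₀) (quotient-*ʳ h₀ h))
  (λ { (divides r q≡rp) →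
       divides r (quotient≡*ʳ⇒∣ {r = r} h q≡rp) , coprime-∣ˡ (divides p (trans q≡rp (*-comm r p))) c })

coprimeCofactor-*-prime⇔ : .{{NonZero m}} → Prime p →
  CoprimeCofactor (k * p) d (m * p) ⇔ (CoprimeCofactor k d (m * p) × ¬ CoprimeCofactor k d m)
coprimeCofactor-*-prime⇔ {m} {p} {k} {d} pp = mk⇔ split join
  where
  open Equivalence
  instance _ = prime⇒nonZero pp
  nonZero : d ∣ m * p → NonZero d
  nonZero = divisor-nonZero {{m*n≢0 m p}}

  split : CoprimeCofactor (k * p) d (m * p) →
          CoprimeCofactor k d (m * p) × ¬ CoprimeCofactor k d m
  split (h , c) with to (coprime-*-prime⇔ pp) c
  ... | c′ , p∤q = (h , c′) , p∤q ∘ to (coprimeCofactor⇔∣quotient {{nonZero h}} h c′)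

  join : CoprimeCofactor k d (m * p) × ¬ CoprimeCofactor k d m →
         CoprimeCofactor (k * p) d (m * p)
  join ((h , c′) , ¬cc) =
    h , from (coprime-*-prime⇔ pp) (c′ , ¬cc ∘ from (coprimeCofactor⇔∣quotient {{nonZero h}} h c′))

lemma3p4 : (a n p : ℕ) → a ≥ 1 → n ≥ 1 → Prime p → ¬ (p ∣ a) →
    (d : ℕ) → InD (a * p) n d ⇔ (InD a (p * n) d × ¬ InD a n d)
lemma3p4 a n p a≥1 n≥1 pp _ d =
  subst₂ (λ x y → CoprimeCofactor (a * p) d x ⇔ (CoprimeCofactor a d y × ¬ InD a n d))
    anp≡apn anp≡a[pn] (coprimeCofactor-*-prime⇔ {{nonZero-an}} pp)
  where
  nonZero-an : NonZero (a * n)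
  nonZero-an = m*n≢0 a n {{>-nonZero a≥1}} {{>-nonZero n≥1}}
  anp≡a[pn] : a * n * p ≡ a * (p * n)
  anp≡a[pn] = trans (*-assoc a n p) (cong (a *_) (*-comm n p))
  anp≡apn : a * n * p ≡ a * p * n
  anp≡apn = trans anp≡a[pn] (sym (*-assoc a p n))
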